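{- Let $n\ge 1$, let $w_0,\dots,w_n$ be $\mathbf{ILP}$-MCSs, $S_1,\dots,S_n$ sets of formulas, and $B\rhd C$ a formula such that $B\rhd C\in w_n$, $w_n\prec_{S_n}w_{n-1}\prec_{S_{n-1}}\cdots\prec_{S_1}w_0$ and $B\in w_0$. Then there is an $\mathbf{ILP}$-MCS $v$ such that $w_n\prec_{Q_n(B)}v$ and $C,\Box\neg C\in v$.
   Context: Formulas are built from $\bot$, propositional variables, $\to$, $\Box$ and binary $\rhd$; $\Diamond A:=\neg\Box\neg A$. $\mathbf{IL}$ is axiomatised by classical tautologies, K, L: $\Box(\Box A\to A)\to\Box A$, J1: $\Box(A\to B)\to A\rhd B$, J2: $(A\rhd B)\wedge(B\rhd C)\to A\rhd C$, J3: $(A\rhd C)\wedge(B\rhd C)\to A\vee B\rhd C$, J4: $A\rhd B\to(\Diamond A\to\Diamond B)$, J5: $\Diamond A\rhd A$, with modus ponens and necessitation. $\mathbf{ILP}$ is $\mathbf{IL}$ plus the scheme $A\rhd B\to\Box(A\rhd B)$. An $\mathbf{ILP}$-MCS is a maximal $\mathbf{ILP}$-consistent set. For MCSs $\Gamma,\Delta$ and a set $S$: $\Gamma\prec_S\Delta$ iff for every formula $A$ and every finite $S'\subseteq S$, $\neg A\rhd\bigvee_{\sigma\in S'}\neg\sigma\in\Gamma$ implies $A,\Box A\in\Delta$ (empty disjunction is $\bot$). For a MCS $\Gamma$ and set $T$: $\Gamma^{\boxdot}_T=\{A,\Box A:\neg A\rhd\bigvee_{\sigma\in T'}\neg\sigma\in\Gamma$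 for some finite $T'\subseteq T\}$. Given $w_0,\dots,w_n$, $S_1,\dots,S_n$ and $B$: $Q_1(B)=S_1\cup\{\Box\neg B\}$ and $Q_{j+1}(B)=S_{j+1}\cup\{\Box\neg B\}\cup(w_j)^{\boxdot}_{Q_j(B)}$. -}

module Defs where

open import Data.Nat using (ℕ; zero; suc)
open import Data.Bool using (Bool; true; false; not; _∨_)
open import Data.List using (List; []; _∷_; foldr)
open import Data.List.Relation.Unary.All using (All)
open import Data.Product using (Σ; _×_; ∃)
open import Data.Sum using (_⊎_)
open import Relation.Binary.PropositionalEquality using (_≡_)
open import Relation.Nullary using (¬_)

infixr 6 _⇒_
infix 7 _▷_

data Fm : Set where
  var : ℕ → Fm
  ⊥'  : Fm
  _⇒_ : Fm → Fm → Fm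
  □   : Fm → Fm
  _▷_ : Fm → Fm → Fm

~_ : Fm → Fm
~ A = A ⇒ ⊥'

⊤' : Fm
⊤' = ~ ⊥'

_∨'_ : Fm → Fm → Fm
A ∨' B = (~ A) ⇒ B

_∧'_ : Fm → Fm → Fm
A ∧' B = ~ (A ⇒ ~ B)

◇ : Fm → Fm
◇ A = ~ □ (~ A)

eval : (Fm → Bool) → Fm → Bool
eval v (var p)   = v (var p)
eval v ⊥'        = false
eval v (A ⇒ B)   = not (eval v A) ∨ eval v B
eval v (□ A)     = v (□ A)
eval v (A ▷ B)   = v (A ▷ B)

Tautology : Fm → Set
Tautology A = (v : Fm → Bool) → eval v A ≡ true

data ILP⊢ : Fm → Set where
  taut : ∀ {A} → Tautology A → ILP⊢ A
  axK  : ∀ {A B} → ILP⊢ (□ (A ⇒ B) ⇒ □ A ⇒ □ B)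
  axL  : ∀ {A} → ILP⊢ (□ (□ A ⇒ A) ⇒ □ A)
  axJ1 : ∀ {A B} → ILP⊢ (□ (A ⇒ B) ⇒ A ▷ B)
  axJ2 : ∀ {A B C} → ILP⊢ ((A ▷ B) ∧' (B ▷ C) ⇒ A ▷ C)
  axJ3 : ∀ {A B C} → ILP⊢ ((A ▷ C) ∧' (B ▷ C) ⇒ (A ∨' B) ▷ C)
  axJ4 : ∀ {A B} → ILP⊢ (A ▷ B ⇒ ◇ A ⇒ ◇ B)
  axJ5 : ∀ {A} → ILP⊢ (◇ A ▷ A)
  axP  : ∀ {A B} → ILP⊢ (A ▷ B ⇒ □ (A ▷ B))
  mp   : ∀ {A B} → ILP⊢ (A ⇒ B) → ILP⊢ A → ILP⊢ B
  nec  : ∀ {A} → ILP⊢ A → ILP⊢ (□ A)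

FmSet : Set₁
FmSet = Fm → Set

_⊆_ : FmSet → FmSet → Set
Γ ⊆ Δ = ∀ {A} → Γ A → Δ A

conj : List Fm → Fm
conj = foldr _∧'_ ⊤'

Consistent : FmSet → Set
Consistent Γ = ¬ (Σ (List Fm) λ L → All Γ L × ILP⊢ (conj L ⇒ ⊥'))

MCS : FmSet → Set₁
MCS Γ = Consistent Γ × ((Δ : FmSet) → Γ ⊆ Δ → Consistent Δ → Δ ⊆ Γ)

disjNeg : List Fm → Fm
disjNeg [] = ⊥'
disjNeg (σ ∷ L) = (~ σ) ∨' disjNeg L

Prec : FmSet → FmSet → FmSet → Set
Prec S Γ Δ = (A : Fm) (L : List Fm) → All S L → Γ ((~ A) ▷ disjNeg L) → Δ A × Δ (□ A)

Boxdot : FmSet → FmSet → FmSet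
Boxdot Γ T A' = Σ Fm λ A → Σ (List Fm) λ L →
  All T L × Γ ((~ A) ▷ disjNeg L) × (A' ≡ A ⊎ A' ≡ □ A)

-- Q w S B j = Q_{j+1}(B)
Q : (w S : ℕ → FmSet) → Fm → ℕ → FmSet
Q w S B zero A = S 1 A ⊎ A ≡ □ (~ B)
Q w S B (suc j) A = (S (suc (suc j)) A ⊎ A ≡ □ (~ B)) ⊎ Boxdot (w (suc j)) (Q w S B j) A

module Submission where

-- Call X "T-bounded in Γ" if X ▷ ⋁_{σ∈M} ¬σ ∈ Γ for some finite M ⊆ T.
-- (1) Descent: along w_{k+1} ≺_{S_{k+1}} w_k, B cannot be Q_k(B)-bounded in
--     w_{k+1}.  For k = 0 a bound would yield ¬B ∈ w_0.  For k+1 we first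
--     remove □¬B from the bound (A ▷ (X ∨ ◇A) gives A ▷ X, a Löb argument),
--     then move the ▷-formula down to w_{k+1} (axiom P), where every element
--     of S_{k+2} ∪ (w_{k+1})^⊡_{Q_k(B)} is itself Q_k(B)-bounded.
-- (2) Since B ▷ C ∈ w_n and ⊢ C ▷ C ∧ □¬C, also E := C ∧ □¬C is not
--     Q_n(B)-bounded in w_n.  Hence (w_n)^⊡_{Q_n(B)} ∪ {C, □¬C} is consistent:
--     a refutation of finitely many of its members would bound E.
-- (3) The Lindenbaum lemma extends this set to the required MCS v.

open import Defs
open import Data.Nat using (ℕ; zero; suc; _≤_; _<_; _≤′_; ≤′-reflexive; ≤′-step; _⊔_; z≤n; s≤s)
open import Data.Nat.Properties using (≤-refl; ≤-trans; n≤1+n; ≤⇒≤′; m≤m⊔n; m≤n⊔m)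
open import Data.Fin using (Fin; zero; suc)
open import Data.Bool using (Bool; true; false; not; _∨_; T)
open import Data.Vec using (Vec; []; _∷_; lookup; map)
open import Data.Vec.Properties using (lookup-map)
open import Data.List using (List; []; _∷_; _++_; cartesianProductWith)
  renaming (map to mapL)
open import Data.List.Membership.Propositional using (_∈_)
open import Data.List.Membership.Propositional.Properties
  using (∈-++⁺ˡ; ∈-++⁺ʳ; ∈-map⁺; ∈-cartesianProductWith⁺)
open import Data.List.Relation.Unary.Any using (here; there)
open import Data.List.Relation.Unary.All as All using (All; []; _∷_)
open import Data.List.Relation.Unary.All.Properties using (++⁺)
open import Data.Product using (Σ; _×_; _,_; proj₁; proj₂)
open import Data.Sum using (_⊎_; inj₁; inj₂)
open import Data.Empty using (⊥)
open import Relation.Nullary using (¬_)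
open import Relation.Binary.PropositionalEquality using (_≡_; refl; cong₂; trans; sym)

-- Propositional schemas over n atoms.  A schema valid in all 2ⁿ rows of its
-- truth table is a theorem of ILP under every instantiation of its atoms.
infixr 6 _⇛_
infixr 7 _∨ˢ_
infixr 8 _∧ˢ_

data Schema (n : ℕ) : Set where
  atom : Fin n → Schema n
  ⊥ˢ   : Schema n
  _⇛_  : Schema n → Schema n → Schema n

¬ˢ_ : ∀ {n} → Schema n → Schema n
¬ˢ s = s ⇛ ⊥ˢ

_∧ˢ_ _∨ˢ_ : ∀ {n} → Schema n → Schema n → Schema n
s ∧ˢ t = ¬ˢ (s ⇛ ¬ˢ t)
s ∨ˢ t = ¬ˢ s ⇛ t

p₀ : ∀ {n} → Schema (suc n)
p₀ = atom zero

p₁ : ∀ {n} → Schema (suc (suc n))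
p₁ = atom (suc zero)

p₂ : ∀ {n} → Schema (suc (suc (suc n)))
p₂ = atom (suc (suc zero))

p₃ : ∀ {n} → Schema (suc (suc (suc (suc n))))
p₃ = atom (suc (suc (suc zero)))

p₄ : ∀ {n} → Schema (suc (suc (suc (suc (suc n)))))
p₄ = atom (suc (suc (suc (suc zero))))

instantiate : ∀ {n} → Vec Fm n → Schema n → Fm
instantiate ρ (atom i) = lookup ρ i
instantiate ρ ⊥ˢ       = ⊥'
instantiate ρ (s ⇛ t)  = instantiate ρ s ⇒ instantiate ρ t

value : ∀ {n} → Vec Bool n → Schema n → Bool
value β (atom i) = lookup β i
value β ⊥ˢ       = false
value β (s ⇛ t)  = not (value β s) ∨ value β t

-- f holds in every row; for a closed f this computes to a product of ⊤s.
AllRows : ∀ n → (Vec Bool n → Bool) → Set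
AllRows zero    f = T (f [])
AllRows (suc n) f = AllRows n (λ β → f (true ∷ β)) × AllRows n (λ β → f (false ∷ β))

allRows-sound : ∀ n {f} → AllRows n f → ∀ β → f β ≡ true
allRows-sound zero    {f} t [] with f []
... | true = refl
allRows-sound (suc n) (t , _) (true ∷ β)  = allRows-sound n t β
allRows-sound (suc n) (_ , t) (false ∷ β) = allRows-sound n t β

eval-instantiate : ∀ {n} v (ρ : Vec Fm n) s → eval v (instantiate ρ s) ≡ value (map (eval v) ρ) s
eval-instantiate v ρ (atom i) = sym (lookup-map i (eval v) ρ)
eval-instantiate v ρ ⊥ˢ       = refl
eval-instantiate v ρ (s ⇛ t)  =
  cong₂ (λ x y → not x ∨ y) (eval-instantiate v ρ s) (eval-instantiate v ρ t)

-- The validity proof is an implicit argument, found by computation.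
tautology : ∀ {n} (s : Schema n) {valid : AllRows n (λ β → value β s)} (ρ : Vec Fm n)
          → ILP⊢ (instantiate ρ s)
tautology {n} s {valid} ρ =
  taut λ v → trans (eval-instantiate v ρ s) (allRows-sound n valid (map (eval v) ρ))

mp₂ : ∀ {A B C} → ILP⊢ (A ⇒ B ⇒ C) → ILP⊢ A → ILP⊢ B → ILP⊢ C
mp₂ p q r = mp (mp p q) r

⇒-trans : ∀ {A B C} → ILP⊢ (A ⇒ B) → ILP⊢ (B ⇒ C) → ILP⊢ (A ⇒ C)
⇒-trans {A} {B} {C} = mp₂ (tautology ((p₀ ⇛ p₁) ⇛ (p₁ ⇛ p₂) ⇛ p₀ ⇛ p₂) (A ∷ B ∷ C ∷ []))

∧-curry : ∀ {A B C} → ILP⊢ (A ∧' B ⇒ C) → ILP⊢ (A ⇒ B ⇒ C)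
∧-curry {A} {B} {C} = mp (tautology ((p₀ ∧ˢ p₁ ⇛ p₂) ⇛ p₀ ⇛ p₁ ⇛ p₂) (A ∷ B ∷ C ∷ []))

▷-trans : ∀ {A B C} → ILP⊢ (A ▷ B) → ILP⊢ (B ▷ C) → ILP⊢ (A ▷ C)
▷-trans = mp₂ (∧-curry axJ2)

▷-∨ : ∀ {A B C} → ILP⊢ (A ▷ C) → ILP⊢ (B ▷ C) → ILP⊢ ((A ∨' B) ▷ C)
▷-∨ = mp₂ (∧-curry axJ3)

□-mono : ∀ {A B} → ILP⊢ (A ⇒ B) → ILP⊢ (□ A ⇒ □ B)
□-mono p = mp axK (nec p)

▷-intro : ∀ {A B} → ILP⊢ (A ⇒ B) → ILP⊢ (A ▷ B)
▷-intro p = mp axJ1 (nec p)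

⇒-refl : ∀ {A} → ILP⊢ (A ⇒ A)
⇒-refl {A} = tautology (p₀ ⇛ p₀) (A ∷ [])

⇒-combine : ∀ {P U V R} → ILP⊢ (P ⇒ U) → ILP⊢ (P ⇒ V) → ILP⊢ (U ∧' V ⇒ R) → ILP⊢ (P ⇒ R)
⇒-combine {P} {U} {V} {R} p q =
  mp (mp₂ (tautology ((p₀ ⇛ p₁) ⇛ (p₀ ⇛ p₂) ⇛ (p₁ ∧ˢ p₂ ⇛ p₃) ⇛ p₀ ⇛ p₃) (P ∷ U ∷ V ∷ R ∷ [])) p q)

⇒-const : ∀ {P U} → ILP⊢ U → ILP⊢ (P ⇒ U)
⇒-const {P} {U} = mp (tautology (p₀ ⇛ p₁ ⇛ p₀) (U ∷ P ∷ []))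

□⇒▷⊥ : ∀ {Y} → ILP⊢ (□ Y ⇒ (~ Y) ▷ ⊥')
□⇒▷⊥ {Y} = ⇒-trans (□-mono (tautology (p₀ ⇛ ¬ˢ ¬ˢ p₀) (Y ∷ []))) axJ1

-- ¬□A ▷ ¬A, since ¬□A implies ◇¬A and ◇¬A ▷ ¬A (J5).
▷-¬□ : ∀ {A} → ILP⊢ ((~ □ A) ▷ (~ A))
▷-¬□ {A} = ▷-trans (▷-intro (mp contrapose (□-mono (tautology (¬ˢ ¬ˢ p₀ ⇛ p₀) (A ∷ []))))) axJ5
  where
    contrapose : ILP⊢ ((□ (~ ~ A) ⇒ □ A) ⇒ (~ □ A) ⇒ ◇ (~ A))
    contrapose = tautology ((p₀ ⇛ p₁) ⇛ ¬ˢ p₁ ⇛ ¬ˢ p₀) (□ (~ ~ A) ∷ □ A ∷ [])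

-- Löb in interpretability form: C ▷ C ∧ □¬C.  By L, □¬(C ∧ □¬C) → □¬C, so
-- C gives (C ∧ □¬C) ∨ ◇(C ∧ □¬C), and ◇E ▷ E by J5.
▷-löb : ∀ {C} → ILP⊢ (C ▷ (C ∧' □ (~ C)))
▷-löb {C} = ▷-trans (▷-intro (mp split □¬E⇒□¬C)) (▷-∨ (▷-intro ⇒-refl) axJ5)
  where
    E : Fm
    E = C ∧' □ (~ C)
    □¬E⇒□¬C : ILP⊢ (□ (~ E) ⇒ □ (~ C))
    □¬E⇒□¬C = ⇒-trans (□-mono (tautology (¬ˢ (p₀ ∧ˢ p₁) ⇛ p₁ ⇛ ¬ˢ p₀) (C ∷ □ (~ C) ∷ []))) axL
    split : ILP⊢ ((□ (~ E) ⇒ □ (~ C)) ⇒ C ⇒ E ∨' ◇ E)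
    split = tautology ((p₂ ⇛ p₁) ⇛ p₀ ⇛ (p₀ ∧ˢ p₁) ∨ˢ ¬ˢ p₂) (C ∷ □ (~ C) ∷ □ (~ E) ∷ [])

-- With φ := A ▷ (X ∨ ◇A) and R := A ▷ X we show
-- □(φ → R) → (φ → R) and conclude by Löb: from □R we get ◇A ▷ ◇X ▷ X (J4, J1,
-- J5), and from φ we get □φ (P), hence □R (K).
▷-absorb-◇ : ∀ {A X} → ILP⊢ (A ▷ (X ∨' ◇ A) ⇒ A ▷ X)
▷-absorb-◇ {A} {X} = mp reflection (mp axL (nec reflection))
  where
    φ R : Fm
    φ = A ▷ (X ∨' ◇ A)
    R = A ▷ X
    □R⇒bound : ILP⊢ (□ R ⇒ (X ∨' ◇ A) ▷ X)
    □R⇒bound = ⇒-combine (⇒-const (▷-intro ⇒-refl))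
                         (⇒-combine (⇒-trans (□-mono axJ4) axJ1) (⇒-const axJ5) axJ2)
                         axJ3
    φ∧□R⇒R : ILP⊢ (φ ∧' □ R ⇒ R)
    φ∧□R⇒R = ⇒-combine (tautology (p₀ ∧ˢ p₁ ⇛ p₀) (φ ∷ □ R ∷ []))
                       (⇒-trans (tautology (p₀ ∧ˢ p₁ ⇛ p₁) (φ ∷ □ R ∷ [])) □R⇒bound)
                       axJ2
    reflection : ILP⊢ (□ (φ ⇒ R) ⇒ φ ⇒ R)
    reflection = mp (mp₂ (tautology ((p₀ ⇛ p₁ ⇛ p₂) ⇛ (p₃ ⇛ p₁) ⇛ (p₃ ∧ˢ p₂ ⇛ p₄) ⇛ p₀ ⇛ p₃ ⇛ p₄)
                                    (□ (φ ⇒ R) ∷ □ φ ∷ □ R ∷ φ ∷ R ∷ []))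
                         axK axP)
                    φ∧□R⇒R

disjNeg-++ˡ : ∀ M N → ILP⊢ (disjNeg M ⇒ disjNeg (M ++ N))
disjNeg-++ˡ [] N      = tautology (⊥ˢ ⇛ p₀) (disjNeg N ∷ [])
disjNeg-++ˡ (σ ∷ M) N = mp (tautology ((p₀ ⇛ p₁) ⇛ (¬ˢ p₂ ∨ˢ p₀) ⇛ (¬ˢ p₂ ∨ˢ p₁))
                                      (disjNeg M ∷ disjNeg (M ++ N) ∷ σ ∷ []))
                           (disjNeg-++ˡ M N)

disjNeg-++ʳ : ∀ M N → ILP⊢ (disjNeg N ⇒ disjNeg (M ++ N))
disjNeg-++ʳ [] N      = ⇒-refl
disjNeg-++ʳ (σ ∷ M) N = ⇒-trans (disjNeg-++ʳ M N)
                                (tautology (p₀ ⇛ ¬ˢ p₁ ∨ˢ p₀) (disjNeg (M ++ N) ∷ σ ∷ []))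

drop-excluded : ∀ {P Q : FmSet} {φ} → (∀ {σ} → Q σ → P σ ⊎ σ ≡ φ) → ∀ {N} → All Q N
              → Σ (List Fm) λ N' → All P N' × ILP⊢ (disjNeg N ⇒ disjNeg N' ∨' (~ φ))
drop-excluded {φ = φ} split [] = [] , [] , tautology (⊥ˢ ⇛ ⊥ˢ ∨ˢ ¬ˢ p₀) (φ ∷ [])
drop-excluded {φ = φ} split {σ ∷ N} (q ∷ qs) with drop-excluded split qs | split q
... | N' , pN' , h | inj₁ p = σ ∷ N' , p ∷ pN' ,
  mp (tautology ((p₀ ⇛ p₁ ∨ˢ ¬ˢ p₂) ⇛ (¬ˢ p₃ ∨ˢ p₀) ⇛ (¬ˢ p₃ ∨ˢ p₁) ∨ˢ ¬ˢ p₂)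
                (disjNeg N ∷ disjNeg N' ∷ φ ∷ σ ∷ []))
     h
... | N' , pN' , h | inj₂ refl = N' , pN' ,
  mp (tautology ((p₀ ⇛ p₁ ∨ˢ ¬ˢ p₂) ⇛ (¬ˢ p₂ ∨ˢ p₀) ⇛ p₁ ∨ˢ ¬ˢ p₂)
                (disjNeg N ∷ disjNeg N' ∷ φ ∷ []))
     h

Derivable : FmSet → Fm → Set
Derivable Γ A = Σ (List Fm) λ L → All Γ L × ILP⊢ (conj L ⇒ A)

conj-++ˡ : ∀ L₁ L₂ → ILP⊢ (conj (L₁ ++ L₂) ⇒ conj L₁)
conj-++ˡ [] L₂       = tautology (p₀ ⇛ ¬ˢ ⊥ˢ) (conj L₂ ∷ [])
conj-++ˡ (x ∷ L₁) L₂ = mp (tautology ((p₀ ⇛ p₁) ⇛ p₂ ∧ˢ p₀ ⇛ p₂ ∧ˢ p₁)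
                                    (conj (L₁ ++ L₂) ∷ conj L₁ ∷ x ∷ []))
                         (conj-++ˡ L₁ L₂)

conj-++ʳ : ∀ L₁ L₂ → ILP⊢ (conj (L₁ ++ L₂) ⇒ conj L₂)
conj-++ʳ [] L₂       = ⇒-refl
conj-++ʳ (x ∷ L₁) L₂ = ⇒-trans (tautology (p₀ ∧ˢ p₁ ⇛ p₁) (x ∷ conj (L₁ ++ L₂) ∷ []))
                               (conj-++ʳ L₁ L₂)

module _ {Γ : FmSet} where

  derivable-mp : ∀ {A B} → Derivable Γ (A ⇒ B) → Derivable Γ A → Derivable Γ B
  derivable-mp {A} {B} (L₁ , γ₁ , ⊢L₁) (L₂ , γ₂ , ⊢L₂) =
    L₁ ++ L₂ , ++⁺ γ₁ γ₂ ,
    mp₂ (tautology ((p₀ ⇛ p₁ ⇛ p₂) ⇛ (p₀ ⇛ p₁) ⇛ p₀ ⇛ p₂) (conj (L₁ ++ L₂) ∷ A ∷ B ∷ []))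
        (⇒-trans (conj-++ˡ L₁ L₂) ⊢L₁) (⇒-trans (conj-++ʳ L₁ L₂) ⊢L₂)

  derivable-theorem : ∀ {A} → ILP⊢ A → Derivable Γ A
  derivable-theorem p = [] , [] , ⇒-const p

  derivable-member : ∀ {A} → Γ A → Derivable Γ A
  derivable-member {A} γ = A ∷ [] , γ ∷ [] , tautology (p₀ ∧ˢ p₁ ⇛ p₀) (A ∷ ⊤' ∷ [])

  derivable-conj : ∀ {L} → All (Derivable Γ) L → Derivable Γ (conj L)
  derivable-conj [] = derivable-theorem (tautology (¬ˢ ⊥ˢ) [])
  derivable-conj {x ∷ L} (d ∷ ds) =
    derivable-mp (derivable-mp (derivable-theorem (tautology (p₀ ⇛ p₁ ⇛ p₀ ∧ˢ p₁) (x ∷ conj L ∷ [])))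
                               d)
                 (derivable-conj ds)

module MCS-Reasoning {Γ : FmSet} (mc : MCS Γ) where

  closed : ∀ {A} → Derivable Γ A → Γ A
  closed = proj₂ mc (Derivable Γ) derivable-member
             λ { (L , ds , p) → proj₁ mc (derivable-mp (derivable-theorem p) (derivable-conj ds)) }

  ∈-theorem : ∀ {A} → ILP⊢ A → Γ A
  ∈-theorem p = closed (derivable-theorem p)

  ∈-mp : ∀ {A B} → Γ (A ⇒ B) → Γ A → Γ B
  ∈-mp p q = closed (derivable-mp (derivable-member p) (derivable-member q))

  ∈-apply : ∀ {A B} → ILP⊢ (A ⇒ B) → Γ A → Γ B
  ∈-apply p = ∈-mp (∈-theorem p)

  ∈-apply₂ : ∀ {A B C} → ILP⊢ (A ⇒ B ⇒ C) → Γ A → Γ B → Γ C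
  ∈-apply₂ p q = ∈-mp (∈-apply p q)

  ∈-contradiction : ∀ {A} → Γ A → Γ (~ A) → ⊥
  ∈-contradiction p q = proj₁ mc (derivable-member (∈-mp q p))

  ∈-▷-intro : ∀ {A B} → ILP⊢ (A ⇒ B) → Γ (A ▷ B)
  ∈-▷-intro p = ∈-theorem (▷-intro p)

  ∈-▷-trans : ∀ {A B C} → Γ (A ▷ B) → Γ (B ▷ C) → Γ (A ▷ C)
  ∈-▷-trans = ∈-apply₂ (∧-curry axJ2)

  ∈-▷-∨ : ∀ {A B C} → Γ (A ▷ C) → Γ (B ▷ C) → Γ ((A ∨' B) ▷ C)
  ∈-▷-∨ = ∈-apply₂ (∧-curry axJ3)

-- Lindenbaum lemma.  `formulas k` is a growing family of finite lists
-- covering all formulas; stage k+1 of the construction decides the formulas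
-- in `formulas k`.
formulas : ℕ → List Fm
formulas zero    = ⊥' ∷ []
formulas (suc k) = formulas k ++ var k ∷ cartesianProductWith _⇒_ (formulas k) (formulas k)
                     ++ mapL □ (formulas k) ++ cartesianProductWith _▷_ (formulas k) (formulas k)

formulas-mono : ∀ {k l A} → k ≤′ l → A ∈ formulas k → A ∈ formulas l
formulas-mono (≤′-reflexive refl) a = a
formulas-mono (≤′-step k≤l) a       = ∈-++⁺ˡ (formulas-mono k≤l a)

module _ {k : ℕ} where
  private
    F : List Fm
    F = formulas k

  ⇒-∈-formulas : ∀ {A B} → A ∈ F → B ∈ F → (A ⇒ B) ∈ formulas (suc k)
  ⇒-∈-formulas a b = ∈-++⁺ʳ F (there (∈-++⁺ˡ (∈-cartesianProductWith⁺ _⇒_ a b)))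

  □-∈-formulas : ∀ {A} → A ∈ F → □ A ∈ formulas (suc k)
  □-∈-formulas a = ∈-++⁺ʳ F (there (∈-++⁺ʳ (cartesianProductWith _⇒_ F F) (∈-++⁺ˡ (∈-map⁺ □ a))))

  ▷-∈-formulas : ∀ {A B} → A ∈ F → B ∈ F → (A ▷ B) ∈ formulas (suc k)
  ▷-∈-formulas a b = ∈-++⁺ʳ F (there (∈-++⁺ʳ (cartesianProductWith _⇒_ F F)
                                        (∈-++⁺ʳ (mapL □ F) (∈-cartesianProductWith⁺ _▷_ a b))))

formulas-pair : ∀ {A B} → (Σ ℕ λ i → A ∈ formulas i) → (Σ ℕ λ j → B ∈ formulas j)
              → Σ ℕ λ k → A ∈ formulas k × B ∈ formulas k
formulas-pair (i , a) (j , b) =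
  i ⊔ j , formulas-mono (≤⇒≤′ (m≤m⊔n i j)) a , formulas-mono (≤⇒≤′ (m≤n⊔m i j)) b

formulas-complete : ∀ A → Σ ℕ λ k → A ∈ formulas k
formulas-complete (var p) = suc p , ∈-++⁺ʳ (formulas p) (here refl)
formulas-complete ⊥'      = zero , here refl
formulas-complete (A ⇒ B) with formulas-pair (formulas-complete A) (formulas-complete B)
... | k , a , b = suc k , ⇒-∈-formulas a b
formulas-complete (□ A) with formulas-complete A
... | k , a = suc k , □-∈-formulas a
formulas-complete (A ▷ B) with formulas-pair (formulas-complete A) (formulas-complete B)
... | k , a , b = suc k , ▷-∈-formulas a b

_∪｛_｝ : FmSet → Fm → FmSet
(Γ ∪｛ φ ｝) A = Γ A ⊎ A ≡ φ

try : FmSet → Fm → FmSet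
try Γ φ A = Γ A ⊎ (A ≡ φ × Consistent (Γ ∪｛ φ ｝))

tryAll : FmSet → List Fm → FmSet
tryAll Γ []      = Γ
tryAll Γ (φ ∷ L) = tryAll (try Γ φ) L

tryAll-⊇ : ∀ Γ L → Γ ⊆ tryAll Γ L
tryAll-⊇ Γ []      γ = γ
tryAll-⊇ Γ (φ ∷ L) γ = tryAll-⊇ (try Γ φ) L (inj₁ γ)

try-consistent : ∀ {Γ} φ → Consistent Γ → Consistent (try Γ φ)
try-consistent {Γ} φ c (L , ts , p) = either (split ts)
  where
    split : ∀ {L} → All (try Γ φ) L → All Γ L ⊎ Consistent (Γ ∪｛ φ ｝)
    split [] = inj₁ []
    split (inj₂ (_ , c') ∷ ts) = inj₂ c'
    split (inj₁ γ ∷ ts) with split ts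
    ... | inj₁ γs = inj₁ (γ ∷ γs)
    ... | inj₂ c' = inj₂ c'
    either : All Γ L ⊎ Consistent (Γ ∪｛ φ ｝) → ⊥
    either (inj₁ γs) = c (L , γs , p)
    either (inj₂ c') = c' (L , All.map (λ { (inj₁ γ) → inj₁ γ ; (inj₂ (e , _)) → inj₂ e }) ts , p)

tryAll-consistent : ∀ {Γ} L → Consistent Γ → Consistent (tryAll Γ L)
tryAll-consistent []      c = c
tryAll-consistent (φ ∷ L) c = tryAll-consistent L (try-consistent φ c)

tryAll-decides : ∀ Δ → Consistent Δ → ∀ Γ L → tryAll Γ L ⊆ Δ → ∀ {A} → Δ A → A ∈ L → tryAll Γ L A
tryAll-decides Δ cΔ Γ (φ ∷ L) sub δ (here refl) = tryAll-⊇ (try Γ φ) L (inj₂ (refl , consistent))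
  where
    consistent : Consistent (Γ ∪｛ φ ｝)
    consistent (M , ms , p) =
      cΔ (M , All.map (λ { (inj₁ γ) → sub (tryAll-⊇ (try Γ φ) L (inj₁ γ)) ; (inj₂ refl) → δ }) ms , p)
tryAll-decides Δ cΔ Γ (φ ∷ L) sub δ (there a) = tryAll-decides Δ cΔ (try Γ φ) L sub δ a

module Lindenbaum (Γ₀ : FmSet) (c₀ : Consistent Γ₀) where

  stage : ℕ → FmSet
  stage zero    = Γ₀
  stage (suc k) = tryAll (stage k) (formulas k)

  stage-mono : ∀ {k l} → k ≤′ l → stage k ⊆ stage l
  stage-mono (≤′-reflexive refl) γ = γ
  stage-mono (≤′-step {l} k≤l) γ  = tryAll-⊇ (stage l) (formulas l) (stage-mono k≤l γ)

  Limit : FmSet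
  Limit A = Σ ℕ λ k → stage k A

  common-stage : ∀ {L} → All Limit L → Σ ℕ λ k → All (stage k) L
  common-stage [] = zero , []
  common-stage ((i , γ) ∷ γs) with common-stage γs
  ... | k , δs = i ⊔ k , stage-mono (≤⇒≤′ (m≤m⊔n i k)) γ
                       ∷ All.map (stage-mono (≤⇒≤′ (m≤n⊔m i k))) δs

  limit-consistent : Consistent Limit
  limit-consistent (L , γs , p) with common-stage γs
  ... | k , δs = stage-consistent k (L , δs , p)
    where
      stage-consistent : ∀ k → Consistent (stage k)
      stage-consistent zero    = c₀
      stage-consistent (suc k) = tryAll-consistent (formulas k) (stage-consistent k)

  limit-maximal : (Δ : FmSet) → Limit ⊆ Δ → Consistent Δ → Δ ⊆ Limit
  limit-maximal Δ sub cΔ {A} δ with formulas-complete A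
  ... | k , a = suc k , tryAll-decides Δ cΔ (stage k) (formulas k) (λ γ → sub (suc k , γ)) δ a

lindenbaum : ∀ {Γ₀} → Consistent Γ₀ → Σ FmSet λ Γ → MCS Γ × Γ₀ ⊆ Γ
lindenbaum {Γ₀} c₀ = Limit , (limit-consistent , limit-maximal) , (λ γ → zero , γ)
  where open Lindenbaum Γ₀ c₀

Bounded : FmSet → FmSet → Fm → Set
Bounded Γ T X = Σ (List Fm) λ M → All T M × Γ (X ▷ disjNeg M)

module _ {Γ : FmSet} (mc : MCS Γ) {T : FmSet} where
  open MCS-Reasoning mc

  bounded-▷ : ∀ {X Y} → Γ (X ▷ Y) → Bounded Γ T Y → Bounded Γ T X
  bounded-▷ h (M , tM , b) = M , tM , ∈-▷-trans h b

  bounded-∨ : ∀ {X Y} → Bounded Γ T X → Bounded Γ T Y → Bounded Γ T (X ∨' Y)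
  bounded-∨ (M , tM , bX) (N , tN , bY) =
    M ++ N , ++⁺ tM tN ,
    ∈-▷-∨ (∈-▷-trans bX (∈-▷-intro (disjNeg-++ˡ M N))) (∈-▷-trans bY (∈-▷-intro (disjNeg-++ʳ M N)))

  bounded-disjNeg : ∀ {L} → All (λ σ → Bounded Γ T (~ σ)) L → Bounded Γ T (disjNeg L)
  bounded-disjNeg []       = [] , [] , ∈-▷-intro ⇒-refl
  bounded-disjNeg (b ∷ bs) = bounded-∨ b (bounded-disjNeg bs)

  -- The members of Γ^⊡_T have T-bounded negations (using ¬□A ▷ ¬A).
  bounded-boxdot : ∀ {σ} → Boxdot Γ T σ → Bounded Γ T (~ σ)
  bounded-boxdot (A , L , tL , h , inj₁ refl) = L , tL , h
  bounded-boxdot (A , L , tL , h , inj₂ refl) = bounded-▷ (∈-theorem ▷-¬□) (L , tL , h)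

  bounded-conj : ∀ {E L} → All (λ x → Bounded Γ T (E ∧' (~ x))) L → Bounded Γ T (E ∧' (~ conj L))
  bounded-conj {E} []       = [] , [] , ∈-▷-intro (tautology (p₀ ∧ˢ ¬ˢ ¬ˢ ⊥ˢ ⇛ ⊥ˢ) (E ∷ []))
  bounded-conj {E} {x ∷ L} (b ∷ bs) =
    bounded-▷ (∈-▷-intro (tautology (p₀ ∧ˢ ¬ˢ (p₁ ∧ˢ p₂) ⇛ (p₀ ∧ˢ ¬ˢ p₁) ∨ˢ (p₀ ∧ˢ ¬ˢ p₂))
                                    (E ∷ x ∷ conj L ∷ [])))
              (bounded-∨ b (bounded-conj bs))

  consistent-if-unbounded : ∀ {E} {X : FmSet} → ¬ Bounded Γ T E
                          → (∀ {x} → X x → Bounded Γ T (E ∧' (~ x))) → Consistent X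
  consistent-if-unbounded {E} unbounded bound (L , xs , refutation) =
    unbounded (bounded-▷ (∈-▷-intro (mp (tautology ((p₁ ⇛ ⊥ˢ) ⇛ p₀ ⇛ p₀ ∧ˢ ¬ˢ p₁) (E ∷ conj L ∷ []))
                                        refutation))
                         (bounded-conj (All.map bound xs)))

-- A bound for A may drop □¬A, as ¬□¬A = ◇A is absorbed by ▷-absorb-◇.
bounded-absorb : ∀ {Γ} → MCS Γ → ∀ {P Q A} → (∀ {σ} → Q σ → P σ ⊎ σ ≡ □ (~ A))
               → Bounded Γ Q A → Bounded Γ P A
bounded-absorb mc split (N , qN , h) with drop-excluded split qN
... | N' , pN' , imp = N' , pN' , ∈-apply ▷-absorb-◇ (∈-▷-trans h (∈-▷-intro imp))
  where open MCS-Reasoning mc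

module _ {S Δ Γ : FmSet} (mcΔ : MCS Δ) (prec : Prec S Δ Γ) where
  open MCS-Reasoning mcΔ

  -- ▷-formulas descend (axiom P gives □(X ▷ Y), i.e. ¬(X ▷ Y) ▷ ⊥).
  prec-▷ : ∀ {X Y} → Δ (X ▷ Y) → Γ (X ▷ Y)
  prec-▷ h = proj₁ (prec _ [] [] (∈-apply □⇒▷⊥ (∈-apply axP h)))

  -- Members of S are boxed in Γ (take A := σ, since ¬σ ▷ ¬σ).
  prec-□ : ∀ {σ} → S σ → Γ (□ σ)
  prec-□ {σ} s = proj₂ (prec σ (σ ∷ []) (s ∷ []) (∈-▷-intro (tautology (¬ˢ p₀ ⇛ ¬ˢ ¬ˢ p₀ ⇛ ⊥ˢ) (σ ∷ []))))

  prec-refutes : ∀ {A} → Bounded Δ S A → Γ (~ A)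
  prec-refutes {A} (N , sN , h) =
    proj₁ (prec (~ A) N sN (∈-▷-trans (∈-▷-intro (tautology (¬ˢ ¬ˢ p₀ ⇛ p₀) (A ∷ []))) h))

  descend : MCS Γ → ∀ {T X} → Bounded Δ (λ σ → S σ ⊎ Boxdot Γ T σ) X → Bounded Γ T X
  descend mcΓ {T} (N , sN , h) = bounded-▷ mcΓ (prec-▷ h) (bounded-disjNeg mcΓ (All.map negation sN))
    where
      negation : ∀ {σ} → S σ ⊎ Boxdot Γ T σ → Bounded Γ T (~ σ)
      negation (inj₁ s) = [] , [] , MCS-Reasoning.∈-apply mcΓ □⇒▷⊥ (prec-□ s)
      negation (inj₂ b) = bounded-boxdot mcΓ b

module Chain (m : ℕ) (w S : ℕ → FmSet) (B : Fm)
             (mcs : ∀ i → i ≤ suc m → MCS (w i))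
             (prec : ∀ i → i < suc m → Prec (S (suc i)) (w (suc i)) (w i))
             (B∈w₀ : w 0 B) where

  B-unbounded : ∀ k → k ≤ m → ¬ Bounded (w (suc k)) (Q w S B k) B
  B-unbounded zero _ b =
    MCS-Reasoning.∈-contradiction (mcs 0 z≤n) B∈w₀
      (prec-refutes (mcs 1 (s≤s z≤n)) (prec 0 (s≤s z≤n)) (bounded-absorb (mcs 1 (s≤s z≤n)) (λ q → q) b))
  B-unbounded (suc k) k<m b =
    B-unbounded k k≤m (descend upper (prec (suc k) (s≤s k<m)) lower (bounded-absorb upper regroup b))
    where
      k≤m : k ≤ m
      k≤m = ≤-trans (n≤1+n k) k<m
      upper : MCS (w (suc (suc k)))
      upper = mcs (suc (suc k)) (s≤s k<m)
      lower : MCS (w (suc k))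
      lower = mcs (suc k) (s≤s k≤m)
      regroup : ∀ {σ} → Q w S B (suc k) σ → (S (suc (suc k)) σ ⊎ Boxdot (w (suc k)) (Q w S B k) σ) ⊎ σ ≡ □ (~ B)
      regroup (inj₁ (inj₁ s)) = inj₁ (inj₁ s)
      regroup (inj₁ (inj₂ e)) = inj₂ e
      regroup (inj₂ d)        = inj₁ (inj₂ d)

boxdot-prec : ∀ {Γ Δ T} → Boxdot Γ T ⊆ Δ → Prec T Γ Δ
boxdot-prec sub A L tL h = sub (A , L , tL , h , inj₁ refl) , sub (A , L , tL , h , inj₂ refl)

witness-seed : FmSet → FmSet → Fm → FmSet
witness-seed Γ T C A = Boxdot Γ T A ⊎ (A ≡ C ⊎ A ≡ □ (~ C))

witness-seed-consistent : ∀ {Γ T C} → MCS Γ → ¬ Bounded Γ T (C ∧' □ (~ C)) → Consistent (witness-seed Γ T C)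
witness-seed-consistent {Γ} {T} {C} mc unbounded = consistent-if-unbounded mc unbounded bound
  where
    open MCS-Reasoning mc
    bound : ∀ {x} → witness-seed Γ T C x → Bounded Γ T ((C ∧' □ (~ C)) ∧' (~ x))
    bound (inj₂ (inj₁ refl)) = [] , [] , ∈-▷-intro (tautology ((p₀ ∧ˢ p₁) ∧ˢ ¬ˢ p₀ ⇛ ⊥ˢ) (C ∷ □ (~ C) ∷ []))
    bound (inj₂ (inj₂ refl)) = [] , [] , ∈-▷-intro (tautology ((p₀ ∧ˢ p₁) ∧ˢ ¬ˢ p₁ ⇛ ⊥ˢ) (C ∷ □ (~ C) ∷ []))
    bound {x} (inj₁ d) =
      bounded-▷ mc (∈-▷-intro (tautology (p₀ ∧ˢ ¬ˢ p₁ ⇛ ¬ˢ p₁) (C ∧' □ (~ C) ∷ x ∷ []))) (bounded-boxdot mc d)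

lemma11p2 : (m : ℕ) (w S : ℕ → FmSet) (B C : Fm)
    → (∀ i → i ≤ suc m → MCS (w i))
    → w (suc m) (B ▷ C)
    → (∀ i → i < suc m → Prec (S (suc i)) (w (suc i)) (w i))
    → w 0 B
    → Σ FmSet λ v → MCS v × Prec (Q w S B m) (w (suc m)) v × v C × v (□ (~ C))
lemma11p2 m w S B C mcs B▷C prec B∈w₀ =
  let v , v-mcs , seed⊆v = lindenbaum (witness-seed-consistent wₙ-mcs E-unbounded)
  in v , v-mcs , boxdot-prec {Γ = w (suc m)} (λ d → seed⊆v (inj₁ d)) ,
     seed⊆v (inj₂ (inj₁ refl)) , seed⊆v (inj₂ (inj₂ refl))
  where
    wₙ-mcs : MCS (w (suc m))
    wₙ-mcs = mcs (suc m) ≤-refl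
    open MCS-Reasoning wₙ-mcs
    -- B ▷ C ▷ C ∧ □¬C, so a bound for C ∧ □¬C would bound B
    E-unbounded : ¬ Bounded (w (suc m)) (Q w S B m) (C ∧' □ (~ C))
    E-unbounded b = Chain.B-unbounded m w S B mcs prec B∈w₀ m ≤-refl
                      (bounded-▷ wₙ-mcs (∈-▷-trans B▷C (∈-theorem ▷-löb)) b)
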